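{- Let $a$ be an even positive integer, let $b>1$ be an integer, let $p$ be an odd prime with $p>\max\{(a-1)/4,\ (b^a-1)/a\}$, and let $n=ap+1$. If $b^{n-1}\equiv 1\pmod n$, then $n$ is prime. -}

module Defs where

{-# OPTIONS --safe #-}
-- Put x = b ^ a, y = x - 1 and S = 1 + x + ... + x ^ (p - 1), so that n = ap + 1 divides
-- x ^ p - 1 = y S.  A prime q ≠ p dividing S has x ^ p ≡ 1 but x ≢ 1 (mod q) (else q ∣ S ≡ p),
-- so by Fermat and Bézout p ∣ q - 1; hence every divisor of S prime to p is ≡ 1 (mod p).
-- A factorisation n = de with d = 1 + kp, e = 1 + lp and k, l > 0 has k, l even (n is odd),
-- so a = k + l + klp > 4p; thus n has no such nontrivial factorisation.  The cofactor of
-- gcd(n, y) in n divides S, so both factors are ≡ 1 (mod p), and gcd(n, y) ≤ y < n forces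
-- gcd(n, y) = 1.  Then n ∣ S, all divisors of n are ≡ 1 (mod p), and n is prime.

module Submission where

open import Defs
open import Data.Nat using (ℕ; suc; _*_; _∸_; _^_; _<_; _%_)
open import Data.Nat.Divisibility using (_∣_)
open import Data.Nat.Primality using (Prime)
open import Relation.Nullary using (¬_)
open import Relation.Binary.PropositionalEquality using (_≡_)

open import Data.Empty using (⊥-elim)
open import Data.Fin.Base using (Fin; zero; suc; toℕ; fromℕ; inject₁)
open import Data.Fin.Properties using (toℕ-fromℕ; toℕ-inject₁; toℕ<n)
open import Data.List.Membership.Propositional using (_∈_)
open import Data.List.Relation.Unary.All as All using (All; []; _∷_)
open import Data.Nat.Base
open import Data.Nat.Combinatorics using (_C_; nC1≡n; nCn≡1; nCk+nC[k+1]≡[n+1]C[k+1])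
open import Data.Nat.Coprimality using (Coprime; coprime-Bézout; coprime-divisor; coprime-/gcd)
open import Data.Nat.DivMod
open import Data.Nat.Divisibility
open import Data.Nat.GCD using (module Bézout; gcd; gcd[m,n]∣m; gcd[m,n]∣n; gcd[m,n]≢0)
open import Data.Nat.ListAction using (product)
open import Data.Nat.ListAction.Properties using (∈⇒∣product)
open import Data.Nat.Primality
open import Data.Nat.Primality.Factorisation using (PrimeFactorisation; factorise)
open import Data.Nat.Properties
open import Data.Nat.Tactic.RingSolver using (solve-∀)
open import Data.Product.Base using (∃-syntax; _,_; proj₂)
open import Data.Sum.Base using (_⊎_; inj₁; inj₂; [_,_]′)
open import Function.Base using (_∘_; id)
open import Relation.Binary.PropositionalEquality
open import Relation.Nullary.Decidable using (yes; no)

open import Algebra.Properties.CommutativeSemigroup *-commutativeSemigroup using (xy∙z≈xz∙y)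
open import Algebra.Definitions.RawSemiring +-*-rawSemiring as ℕ-Semiring using ()
open import Algebra.Properties.CommutativeSemiring.Binomial +-*-commutativeSemiring
  using (theorem; binomial; binomialTerm)
open import Algebra.Properties.Monoid.Sum +-0-monoid using (sum; sum-init-last)

semiring-^≡^ : ∀ x n → x ℕ-Semiring.^ n ≡ x ^ n
semiring-^≡^ x zero    = refl
semiring-^≡^ x (suc n) = cong (x *_) (semiring-^≡^ x n)

semiring-×≡* : ∀ n x → n ℕ-Semiring.× x ≡ n * x
semiring-×≡* zero    x = refl
semiring-×≡* (suc n) x = cong (x +_) (semiring-×≡* n x)

∣-sum : ∀ {d n} (f : Fin n → ℕ) → (∀ i → d ∣ f i) → d ∣ sum f
∣-sum {n = zero}  f d∣f = _ ∣0
∣-sum {n = suc n} f d∣f = ∣m∣n⇒∣m+n (d∣f zero) (∣-sum (f ∘ suc) (d∣f ∘ suc))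

[1+k]*[1+n]C[1+k]≡[1+n]*nCk : ∀ n k → suc k * (suc n C suc k) ≡ suc n * (n C k)
[1+k]*[1+n]C[1+k]≡[1+n]*nCk zero    zero    = refl
[1+k]*[1+n]C[1+k]≡[1+n]*nCk zero    (suc k) = *-zeroʳ (2 + k)
[1+k]*[1+n]C[1+k]≡[1+n]*nCk (suc n) zero    =
  trans (*-identityˡ _) (trans (nC1≡n (2 + n)) (sym (*-identityʳ (2 + n))))
[1+k]*[1+n]C[1+k]≡[1+n]*nCk (suc n) (suc k) = begin
  (2 + k) * (suc (suc n) C suc (suc k))
    ≡⟨ cong ((2 + k) *_) (nCk+nC[k+1]≡[n+1]C[k+1] (suc n) (suc k)) ⟨
  (2 + k) * (c + d)
    ≡⟨ rearrange k c d ⟩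
  c + ((1 + k) * c + (2 + k) * d)
    ≡⟨ cong₂ (λ u v → c + (u + v)) ([1+k]*[1+n]C[1+k]≡[1+n]*nCk n k)
                                   ([1+k]*[1+n]C[1+k]≡[1+n]*nCk n (suc k)) ⟩
  c + ((1 + n) * (n C k) + (1 + n) * (n C suc k))
    ≡⟨ cong (c +_) (*-distribˡ-+ (1 + n) (n C k) (n C suc k)) ⟨
  c + (1 + n) * (n C k + n C suc k)
    ≡⟨ cong (λ e → c + (1 + n) * e) (nCk+nC[k+1]≡[n+1]C[k+1] n k) ⟩
  c + (1 + n) * c
    ∎
  where
  open ≡-Reasoning
  c = suc n C suc k
  d = suc n C suc (suc k)
  rearrange : ∀ k c d → (2 + k) * (c + d) ≡ c + ((1 + k) * c + (2 + k) * d)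
  rearrange = solve-∀

prime∣pCk : ∀ {p k} → Prime p → 0 < k → k < p → p ∣ p C k
prime∣pCk {suc m} {suc j} p-prime _ j<m
  with euclidsLemma (suc j) (suc m C suc j) p-prime
         (divides (m C j) (trans ([1+k]*[1+n]C[1+k]≡[1+n]*nCk m j) (*-comm (suc m) (m C j))))
... | inj₁ p∣k = ⊥-elim (<⇒≱ j<m (∣⇒≤ p∣k))
... | inj₂ p∣C = p∣C

C∣binomialTerm : ∀ x y n k → n C toℕ k ∣ binomialTerm x y n k
C∣binomialTerm x y n k = divides (binomial x y n k)
  (trans (semiring-×≡* (n C toℕ k) (binomial x y n k)) (*-comm (n C toℕ k) (binomial x y n k)))

binomialTerm-first : ∀ x n → binomialTerm 1 x n zero ≡ x ^ n
binomialTerm-first x n = trans (+-identityʳ _) (trans (+-identityʳ _) (semiring-^≡^ x n))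

binomialTerm-last : ∀ x n → binomialTerm 1 x n (fromℕ n) ≡ 1
binomialTerm-last x n rewrite toℕ-fromℕ n | nCn≡1 n | n∸n≡0 n =
  trans (+-identityʳ _) (trans (*-identityʳ _) (trans (semiring-^≡^ 1 n) (^-zeroˡ n)))

prime∣binomialTerm-middle : ∀ {m} x → Prime (suc m) → (i : Fin m) →
                            suc m ∣ binomialTerm 1 x (suc m) (suc (inject₁ i))
prime∣binomialTerm-middle {m} x p-prime i = ∣-trans
  (prime∣pCk p-prime z<s (s≤s (subst (_< m) (sym (toℕ-inject₁ i)) (toℕ<n i))))
  (C∣binomialTerm 1 x (suc m) (suc (inject₁ i)))

[1+x]^p%p≡[1+x^p]%p : ∀ {p} x → Prime p → .{{_ : NonZero p}} → (1 + x) ^ p % p ≡ (1 + x ^ p) % p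
[1+x]^p%p≡[1+x^p]%p {suc m} x p-prime = begin
  (1 + x) ^ p % p
    ≡⟨ cong (_% p) (trans (sym (semiring-^≡^ (1 + x) p)) (theorem p 1 x)) ⟩
  (t zero + sum (t ∘ suc)) % p
    ≡⟨ cong (λ s → (t zero + s) % p) (sum-init-last (t ∘ suc)) ⟩
  (t zero + (middle + t (fromℕ p))) % p
    ≡⟨ cong₂ (λ u v → (u + (middle + v)) % p) (binomialTerm-first x p) (binomialTerm-last x p) ⟩
  (x ^ p + (middle + 1)) % p
    ≡⟨ cong (_% p) (rearrange (x ^ p) middle) ⟩
  (1 + x ^ p + middle) % p
    ≡⟨ %-remove-+ʳ (1 + x ^ p) (∣-sum (t ∘ suc ∘ inject₁) (prime∣binomialTerm-middle x p-prime)) ⟩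
  (1 + x ^ p) % p
    ∎
  where
  open ≡-Reasoning
  p = suc m
  t = binomialTerm 1 x p
  middle = sum (t ∘ suc ∘ inject₁)
  rearrange : ∀ a b → a + (b + 1) ≡ 1 + a + b
  rearrange = solve-∀

fermat's-little-theorem : ∀ {p} x → Prime p → .{{_ : NonZero p}} → x ^ p % p ≡ x % p
fermat's-little-theorem {suc m} zero    p-prime = refl
fermat's-little-theorem {suc m} (suc x) p-prime = begin
  (1 + x) ^ p % p                ≡⟨ [1+x]^p%p≡[1+x^p]%p x p-prime ⟩
  (1 + x ^ p) % p                ≡⟨ %-distribˡ-+ 1 (x ^ p) p ⟩
  (1 % p + x ^ p % p) % p        ≡⟨ cong (λ r → (1 % p + r) % p) (fermat's-little-theorem x p-prime) ⟩
  (1 % p + x % p) % p            ≡⟨ %-distribˡ-+ 1 x p ⟨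
  (1 + x) % p                    ∎
  where
  open ≡-Reasoning
  p = suc m

module _ {q : ℕ} .{{_ : NonZero q}} where

  %≡%⇒∣∸ : ∀ a b → b ≤ a → a % q ≡ b % q → q ∣ a ∸ b
  %≡%⇒∣∸ a b b≤a a≡b = divides (a / q ∸ b / q) (begin
    a ∸ b
      ≡⟨ cong₂ _∸_ (m≡m%n+[m/n]*n a q) (m≡m%n+[m/n]*n b q) ⟩
    (a % q + a / q * q) ∸ (b % q + b / q * q)
      ≡⟨ cong (λ r → (r + a / q * q) ∸ (b % q + b / q * q)) a≡b ⟩
    (b % q + a / q * q) ∸ (b % q + b / q * q)
      ≡⟨ [m+n]∸[m+o]≡n∸o (b % q) _ _ ⟩
    a / q * q ∸ b / q * q
      ≡⟨ *-distribʳ-∸ q (a / q) (b / q) ⟨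
    (a / q ∸ b / q) * q
      ∎)
    where open ≡-Reasoning

  ∣∸⇒%≡% : ∀ a b → b ≤ a → q ∣ a ∸ b → a % q ≡ b % q
  ∣∸⇒%≡% a b b≤a (divides k a∸b≡kq) = begin
    a % q             ≡⟨ cong (_% q) (m+[n∸m]≡n b≤a) ⟨
    (b + (a ∸ b)) % q ≡⟨ cong (λ r → (b + r) % q) a∸b≡kq ⟩
    (b + k * q) % q   ≡⟨ [m+kn]%n≡m%n b k q ⟩
    b % q             ∎
    where open ≡-Reasoning

  %-cong-* : ∀ {a b c d} → a % q ≡ b % q → c % q ≡ d % q → a * c % q ≡ b * d % q
  %-cong-* {a} {b} {c} {d} a≡b c≡d = begin
    a * c % q               ≡⟨ %-distribˡ-* a c q ⟩
    (a % q) * (c % q) % q   ≡⟨ cong₂ (λ r s → r * s % q) a≡b c≡d ⟩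
    (b % q) * (d % q) % q   ≡⟨ %-distribˡ-* b d q ⟨
    b * d % q               ∎
    where open ≡-Reasoning

  %-cong-^ : ∀ {a b} k → a % q ≡ b % q → a ^ k % q ≡ b ^ k % q
  %-cong-^ zero    a≡b = refl
  %-cong-^ (suc k) a≡b = %-cong-* a≡b (%-cong-^ k a≡b)

  ^≡1⇒^*≡1 : ∀ {x} k e → x ^ e % q ≡ 1 % q → x ^ (k * e) % q ≡ 1 % q
  ^≡1⇒^*≡1 {x} k e xᵉ≡1 = begin
    x ^ (k * e) % q   ≡⟨ cong (λ r → x ^ r % q) (*-comm k e) ⟩
    x ^ (e * k) % q   ≡⟨ cong (_% q) (^-*-assoc x e k) ⟨
    (x ^ e) ^ k % q   ≡⟨ %-cong-^ k xᵉ≡1 ⟩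
    1 ^ k % q         ≡⟨ cong (_% q) (^-zeroˡ k) ⟩
    1 % q             ∎
    where open ≡-Reasoning

  ^≡1∧^suc≡1⇒≡1 : ∀ {x} e → x ^ e % q ≡ 1 % q → x ^ suc e % q ≡ 1 % q → x % q ≡ 1 % q
  ^≡1∧^suc≡1⇒≡1 {x} e xᵉ≡1 x¹⁺ᵉ≡1 = begin
    x % q           ≡⟨ cong (_% q) (*-identityʳ x) ⟨
    x * 1 % q       ≡⟨ %-cong-* {x} refl (sym xᵉ≡1) ⟩
    x * x ^ e % q   ≡⟨ x¹⁺ᵉ≡1 ⟩
    1 % q           ∎
    where open ≡-Reasoning

  coprime-exponents⇒≡1 : ∀ {x m n} → Coprime m n →
                         x ^ m % q ≡ 1 % q → x ^ n % q ≡ 1 % q → x % q ≡ 1 % q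
  coprime-exponents⇒≡1 {x} {m} {n} m⊥n xᵐ≡1 xⁿ≡1 with coprime-Bézout m⊥n
  ... | Bézout.+- u v 1+vn≡um = ^≡1∧^suc≡1⇒≡1 (v * n) (^≡1⇒^*≡1 v n xⁿ≡1)
                                  (subst (λ e → x ^ e % q ≡ 1 % q) (sym 1+vn≡um) (^≡1⇒^*≡1 u m xᵐ≡1))
  ... | Bézout.-+ u v 1+um≡vn = ^≡1∧^suc≡1⇒≡1 (u * m) (^≡1⇒^*≡1 u m xᵐ≡1)
                                  (subst (λ e → x ^ e % q ≡ 1 % q) (sym 1+um≡vn) (^≡1⇒^*≡1 v n xⁿ≡1))

  %-cancelˡ-* : Prime q → ∀ {a c d} → ¬ q ∣ a → a * c % q ≡ a * d % q → c % q ≡ d % q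
  %-cancelˡ-* q-prime {a} {c} {d} q∤a ac≡ad =
    [ (λ c≤d → sym (cancel c≤d (sym ac≡ad))) , (λ d≤c → cancel d≤c ac≡ad) ]′ (≤-total c d)
    where
    cancel : ∀ {c d} → d ≤ c → a * c % q ≡ a * d % q → c % q ≡ d % q
    cancel {c} {d} d≤c ac≡ad with euclidsLemma a (c ∸ d) q-prime
      (subst (q ∣_) (sym (*-distribˡ-∸ a c d)) (%≡%⇒∣∸ (a * c) (a * d) (*-monoʳ-≤ a d≤c) ac≡ad))
    ... | inj₁ q∣a   = ⊥-elim (q∤a q∣a)
    ... | inj₂ q∣c∸d = ∣∸⇒%≡% c d d≤c q∣c∸d

infix 4 _≡1-mod_

_≡1-mod_ : ℕ → ℕ → Set
m ≡1-mod p = ∃[ k ] m ≡ 1 + k * p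

≡1-mod-* : ∀ {p m n} → m ≡1-mod p → n ≡1-mod p → m * n ≡1-mod p
≡1-mod-* {p} (k , refl) (l , refl) = k + l + k * l * p , expand k l p
  where
  expand : ∀ k l p → (1 + k * p) * (1 + l * p) ≡ 1 + (k + l + k * l * p) * p
  expand = solve-∀

product-≡1-mod : ∀ {p ms} → All (_≡1-mod p) ms → product ms ≡1-mod p
product-≡1-mod []             = 0 , refl
product-≡1-mod (m≡1 ∷ ms≡1) = ≡1-mod-* m≡1 (product-≡1-mod ms≡1)

geometric : ℕ → ℕ → ℕ
geometric x zero    = 0
geometric x (suc k) = 1 + x * geometric x k

[1+y]^k≡1+y*geometric : ∀ y k → suc y ^ k ≡ 1 + y * geometric (suc y) k
[1+y]^k≡1+y*geometric y zero    = cong suc (sym (*-zeroʳ y))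
[1+y]^k≡1+y*geometric y (suc k) = begin
  suc y * suc y ^ k                     ≡⟨ cong (suc y *_) ([1+y]^k≡1+y*geometric y k) ⟩
  suc y * (1 + y * geometric (suc y) k) ≡⟨ expand y (geometric (suc y) k) ⟩
  1 + y * geometric (suc y) (suc k)     ∎
  where
  open ≡-Reasoning
  expand : ∀ y s → suc y * (1 + y * s) ≡ 1 + y * (1 + suc y * s)
  expand = solve-∀

geometric≡k+y*_ : ∀ y k → ∃[ t ] geometric (suc y) k ≡ k + y * t
geometric≡k+y*_ y zero    = 0 , sym (*-zeroʳ y)
geometric≡k+y*_ y (suc k) with geometric≡k+y*_ y k
... | t , G≡k+yt = t + G , (begin
  1 + suc y * G           ≡⟨ cong (λ r → 1 + r + y * G) G≡k+yt ⟩
  1 + (k + y * t) + y * G ≡⟨ regroup k y t G ⟩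
  suc k + y * (t + G)     ∎)
  where
  open ≡-Reasoning
  G = geometric (suc y) k
  regroup : ∀ k y t G → 1 + (k + y * t) + y * G ≡ suc k + y * (t + G)
  regroup = solve-∀

∣y∧∣geometric⇒∣k : ∀ {d} y k → d ∣ y → d ∣ geometric (suc y) k → d ∣ k
∣y∧∣geometric⇒∣k y k d∣y d∣G with geometric≡k+y*_ y k
... | t , G≡k+yt =
  ∣m+n∣m⇒∣n (subst (_ ∣_) (trans G≡k+yt (+-comm k (y * t))) d∣G) (∣m⇒∣m*n t d∣y)

prime∤⇒coprime : ∀ {p m} → Prime p → ¬ p ∣ m → Coprime p m
prime∤⇒coprime {p} {m} p-prime p∤m (d∣p , d∣m) with prime⇒irreducible p-prime d∣p
... | inj₁ d≡1 = d≡1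
... | inj₂ d≡p = ⊥-elim (p∤m (subst (_∣ m) d≡p d∣m))

prime∣geometric⇒≡1-mod : ∀ {p q} y → Prime p → Prime q →
                         q ∣ geometric (suc y) p → q ≢ p → q ≡1-mod p
prime∣geometric⇒≡1-mod {p@(suc p′)} {q@(suc (suc r))} y p-prime q-prime q∣G q≢p with p ∣? suc r
... | yes (divides k r+1≡kp) = k , cong suc r+1≡kp
... | no p∤r+1 = ⊥-elim (q≢p q≡p)
  where
  x = suc y
  xᵖ≡1 : x ^ p % q ≡ 1 % q
  xᵖ≡1 = trans (cong (_% q) ([1+y]^k≡1+y*geometric y p)) (%-remove-+ʳ 1 (∣n⇒∣m*n y q∣G))
  q∤x : ¬ q ∣ x
  q∤x q∣x = 0≢1+n (trans (sym (n∣m⇒m%n≡0 (x ^ p) q (∣m⇒∣m*n (x ^ p′) q∣x))) xᵖ≡1)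
  xʳ⁺¹≡1 : x ^ suc r % q ≡ 1 % q
  xʳ⁺¹≡1 = %-cancelˡ-* q-prime {x} {x ^ suc r} {1} q∤x
    (trans (fermat's-little-theorem x q-prime) (cong (_% q) (sym (*-identityʳ x))))
  q∣y : q ∣ y
  q∣y = %≡%⇒∣∸ x 1 (s≤s z≤n)
    (coprime-exponents⇒≡1 {q} {x} (prime∤⇒coprime p-prime p∤r+1) xᵖ≡1 xʳ⁺¹≡1)
  q≡p : q ≡ p
  q≡p = [ (λ ()) , id ]′ (prime⇒irreducible p-prime (∣y∧∣geometric⇒∣k y p q∣y q∣G))

∣geometric⇒≡1-mod : ∀ {p m} y → Prime p → m ∣ geometric (suc y) p → ¬ p ∣ m → m ≡1-mod p
∣geometric⇒≡1-mod {suc p′} {zero} y p-prime 0∣G p∤m = ⊥-elim (1+n≢0 (0∣⇒≡0 0∣G))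
∣geometric⇒≡1-mod {p} {m@(suc _)} y p-prime m∣G p∤m =
  subst (_≡1-mod p) (sym isFactorisation) (product-≡1-mod (All.tabulate factor≡1))
  where
  open PrimeFactorisation (factorise m)
  factor≡1 : ∀ {q} → q ∈ factors → q ≡1-mod p
  factor≡1 q∈ = prime∣geometric⇒≡1-mod y p-prime (All.lookup factorsPrime q∈)
    (∣-trans (∈⇒∣product q∈) (subst (_∣ geometric (suc y) p) isFactorisation m∣G))
    (λ { refl → p∤m (subst (p ∣_) (sym isFactorisation) (∈⇒∣product q∈)) })

∣m∧∣1+m⇒≡1 : ∀ {d m} → d ∣ m → d ∣ 1 + m → d ≡ 1
∣m∧∣1+m⇒≡1 {d} {m} d∣m d∣1+m = ∣1⇒≡1 (∣m+n∣m⇒∣n (subst (d ∣_) (+-comm 1 m) d∣1+m) d∣m)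

2∤⇒2∣suc : ∀ {m} → ¬ 2 ∣ m → 2 ∣ suc m
2∤⇒2∣suc {zero}        2∤m = ⊥-elim (2∤m (2 ∣0))
2∤⇒2∣suc {suc zero}    2∤m = ∣-refl
2∤⇒2∣suc {suc (suc m)} 2∤m = ∣m∣n⇒∣m+n (∣-refl {2}) (2∤⇒2∣suc (2∤m ∘ ∣m∣n⇒∣m+n (∣-refl {2})))

2∤1+kp⇒2∣k : ∀ {k p} → ¬ 2 ∣ p → ¬ 2 ∣ 1 + k * p → 2 ∣ k
2∤1+kp⇒2∣k {k} {p} 2∤p 2∤1+kp with 2 ∣? k * p
... | no 2∤kp  = ⊥-elim (2∤1+kp (2∤⇒2∣suc 2∤kp))
... | yes 2∣kp = [ id , ⊥-elim ∘ 2∤p ]′ (euclidsLemma k p prime[2] 2∣kp)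

≡1-mod-Irreducible : ℕ → ℕ → Set
≡1-mod-Irreducible p n = ∀ {d e} → d * e ≡ n → d ≡1-mod p → e ≡1-mod p → d ≡ 1 ⊎ e ≡ 1

1+ap-≡1-mod-irreducible : ∀ {a p} .{{_ : NonZero p}} → ¬ 2 ∣ p → 2 ∣ a → a ≤ 4 * p →
                           ≡1-mod-Irreducible p (1 + a * p)
1+ap-≡1-mod-irreducible _ _ _ _ (zero , d≡1) _            = inj₁ d≡1
1+ap-≡1-mod-irreducible _ _ _ _ (suc _ , _)  (zero , e≡1) = inj₂ e≡1
1+ap-≡1-mod-irreducible {a} {p} 2∤p 2∣a a≤4p {d} {e} de≡n (suc k , refl) (suc l , refl) =
  ⊥-elim (<⇒≱ 4p<a a≤4p)
  where
  K = suc k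
  L = suc l
  2∤n : ¬ 2 ∣ 1 + a * p
  2∤n = (λ ()) ∘ ∣m∧∣1+m⇒≡1 (∣m⇒∣m*n p 2∣a)
  2≤K : 2 ≤ K
  2≤K = ∣⇒≤ (2∤1+kp⇒2∣k 2∤p (2∤n ∘ subst (2 ∣_) de≡n ∘ ∣m⇒∣m*n e))
  2≤L : 2 ≤ L
  2≤L = ∣⇒≤ (2∤1+kp⇒2∣k 2∤p (2∤n ∘ subst (2 ∣_) de≡n ∘ ∣n⇒∣m*n d))
  a≡K+L+KLp : K + L + K * L * p ≡ a
  a≡K+L+KLp = *-cancelʳ-≡ _ a p
    (suc-injective (trans (sym (proj₂ (≡1-mod-* (K , refl) (L , refl)))) de≡n))
  4p<a : 4 * p < a
  4p<a = begin-strict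
    4 * p             ≤⟨ *-monoˡ-≤ p (*-mono-≤ 2≤K 2≤L) ⟩
    K * L * p         <⟨ m<n+m (K * L * p) {K + L} z<s ⟩
    K + L + K * L * p ≡⟨ a≡K+L+KLp ⟩
    a                 ∎
    where open ≤-Reasoning

≡1-mod-cofactor : ∀ {p d e n} .{{_ : NonZero p}} → 1 < p →
                  d * e ≡ n → n ≡1-mod p → d ≡1-mod p → e ≡1-mod p
≡1-mod-cofactor {p} {e = e} 1<p de≡n (a , refl) (k , refl) =
  e / p , trans (m≡m%n+[m/n]*n e p) (cong (_+ e / p * p) e%p≡1)
  where
  e%p≡1 : e % p ≡ 1
  e%p≡1 = begin
    e % p                 ≡⟨ [m+kn]%n≡m%n e (k * e) p ⟨
    (e + k * e * p) % p   ≡⟨ cong (_% p) (factor e k p) ⟩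
    (1 + k * p) * e % p   ≡⟨ cong (_% p) de≡n ⟩
    (1 + a * p) % p       ≡⟨ [m+kn]%n≡m%n 1 a p ⟩
    1 % p                 ≡⟨ m<n⇒m%n≡m 1<p ⟩
    1                     ∎
    where
    open ≡-Reasoning
    factor : ∀ e k p → e + k * e * p ≡ (1 + k * p) * e
    factor = solve-∀

/gcd∣ : ∀ n y {s} .{{_ : NonZero (gcd n y)}} → n ∣ y * s → n / gcd n y ∣ s
/gcd∣ n y {s} n∣ys = coprime-divisor (coprime-/gcd n y) (*-cancelʳ-∣ g (subst₂ _∣_ n≡ ys≡ n∣ys))
  where
  g = gcd n y
  n≡ : n ≡ n / g * g
  n≡ = sym (m/n*n≡m (gcd[m,n]∣m n y))
  ys≡ : y * s ≡ y / g * s * g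
  ys≡ = trans (cong (_* s) (sym (m/n*n≡m (gcd[m,n]∣n n y)))) (xy∙z≈xz∙y (y / g) g s)

∣y*geometric⇒∣geometric : ∀ {p n} y → Prime p → ¬ p ∣ n → n ≡1-mod p → ≡1-mod-Irreducible p n →
                          0 < y → y < n → n ∣ y * geometric (suc y) p → n ∣ geometric (suc y) p
∣y*geometric⇒∣geometric {p} {n} y p-prime p∤n n≡1 irreducible 0<y y<n n∣yG =
  [ ⊥-elim ∘ B≢1 , A≡1⇒n∣G ]′ (irreducible BA≡n B≡1-mod A≡1-mod)
  where
  instance
    _ = prime⇒nonZero p-prime
    _ = ≢-nonZero (gcd[m,n]≢0 n y (inj₂ (≢-nonZero⁻¹ y {{>-nonZero 0<y}})))
  A = gcd n y
  B = n / A
  BA≡n : B * A ≡ n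
  BA≡n = m/n*n≡m (gcd[m,n]∣m n y)
  B∣G : B ∣ geometric (suc y) p
  B∣G = /gcd∣ n y n∣yG
  B≡1-mod : B ≡1-mod p
  B≡1-mod = ∣geometric⇒≡1-mod y p-prime B∣G (p∤n ∘ λ p∣B → ∣-trans p∣B (m/n∣m (gcd[m,n]∣m n y)))
  A≡1-mod : A ≡1-mod p
  A≡1-mod = ≡1-mod-cofactor (nonTrivial⇒n>1 p {{prime⇒nonTrivial p-prime}}) BA≡n n≡1 B≡1-mod
  B≢1 : B ≢ 1
  B≢1 B≡1 = <⇒≱ y<n (begin
    n     ≡⟨ BA≡n ⟨
    B * A ≡⟨ cong (_* A) B≡1 ⟩
    1 * A ≡⟨ *-identityˡ A ⟩
    A     ≤⟨ ∣⇒≤ {{>-nonZero 0<y}} (gcd[m,n]∣n n y) ⟩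
    y     ∎)
    where open ≤-Reasoning
  A≡1⇒n∣G : A ≡ 1 → n ∣ geometric (suc y) p
  A≡1⇒n∣G A≡1 = subst (_∣ geometric (suc y) p) B≡n B∣G
    where
    B≡n : B ≡ n
    B≡n = trans (sym (*-identityʳ B)) (trans (cong (B *_) (sym A≡1)) BA≡n)

≡1-mod-irreducible⇒prime : ∀ {p n} → 1 < n → ≡1-mod-Irreducible p n →
                           (∀ {d} → d ∣ n → d ≡1-mod p) → Prime n
≡1-mod-irreducible⇒prime {n = n} 1<n irreducible divisor≡1 =
  ¬composite⇒prime {{n>1⇒nonTrivial 1<n}} ¬composite
  where
  ¬composite : ¬ Composite n
  ¬composite (composite {d} d<n d∣n) =
    [ (λ d≡1 → <-irrefl (sym d≡1) (nonTrivial⇒n>1 d)) , (λ e≡1 → <-irrefl (d≡n e≡1) d<n) ]′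
      (irreducible (sym n≡de) (divisor≡1 d∣n) (divisor≡1 (quotient-∣ d∣n)))
    where
    n≡de : n ≡ d * quotient d∣n
    n≡de = m∣n⇒n≡m*quotient d∣n
    d≡n : quotient d∣n ≡ 1 → d ≡ n
    d≡n e≡1 = trans (sym (*-identityʳ d)) (trans (cong (d *_) (sym e≡1)) (sym n≡de))

corollary2p1 : (a b p : ℕ) → 0 < a → 2 ∣ a → 1 < b → Prime p → ¬ (2 ∣ p)
    → a ∸ 1 < 4 * p → b ^ a ∸ 1 < a * p
    → b ^ (a * p) % suc (a * p) ≡ 1 % suc (a * p)
    → Prime (suc (a * p))
corollary2p1 a b p 0<a 2∣a 1<b p-prime 2∤p a∸1<4p bᵃ∸1<ap bᵃᵖ≡1 =
  ≡1-mod-irreducible⇒prime 1<n irreducible divisor≡1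
  where
  instance _ = prime⇒nonZero p-prime
  n = suc (a * p)
  y = b ^ a ∸ 1
  1<n : 1 < n
  1<n = s≤s (*-mono-≤ 0<a (>-nonZero⁻¹ p))
  p∤n : ¬ p ∣ n
  p∤n = ¬prime[1] ∘ (λ p≡1 → subst Prime p≡1 p-prime) ∘ ∣m∧∣1+m⇒≡1 (n∣m*n a)
  irreducible : ≡1-mod-Irreducible p n
  irreducible = 1+ap-≡1-mod-irreducible 2∤p 2∣a a≤4p
    where
    a≤4p : a ≤ 4 * p
    a≤4p = subst (_≤ 4 * p) (trans (+-comm 1 (a ∸ 1)) (m∸n+n≡m 0<a)) a∸1<4p
  2≤bᵃ : 2 ≤ b ^ a
  2≤bᵃ = ≤-trans (^-monoʳ-≤ 2 0<a) (^-monoˡ-≤ a 1<b)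
  1+y≡bᵃ : suc y ≡ b ^ a
  1+y≡bᵃ = trans (+-comm 1 y) (m∸n+n≡m (≤-trans (s≤s z≤n) 2≤bᵃ))
  n∣yG : n ∣ y * geometric (suc y) p
  n∣yG = %≡%⇒∣∸ (1 + y * geometric (suc y) p) 1 (s≤s z≤n) (begin
    (1 + y * geometric (suc y) p) % n ≡⟨ cong (_% n) ([1+y]^k≡1+y*geometric y p) ⟨
    suc y ^ p % n                     ≡⟨ cong (λ x → x ^ p % n) 1+y≡bᵃ ⟩
    (b ^ a) ^ p % n                   ≡⟨ cong (_% n) (^-*-assoc b a p) ⟩
    b ^ (a * p) % n                   ≡⟨ bᵃᵖ≡1 ⟩
    1 % n                             ∎)
    where open ≡-Reasoning
  n∣G : n ∣ geometric (suc y) p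
  n∣G = ∣y*geometric⇒∣geometric y p-prime p∤n (a , refl) irreducible
          (∸-monoˡ-≤ 1 2≤bᵃ) (m<n⇒m<1+n bᵃ∸1<ap) n∣yG
  divisor≡1 : ∀ {d} → d ∣ n → d ≡1-mod p
  divisor≡1 d∣n = ∣geometric⇒≡1-mod y p-prime (∣-trans d∣n n∣G) (p∤n ∘ λ p∣d → ∣-trans p∣d d∣n)
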